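{- Let $\mathcal{D}$ be a database of documents from $\Sigma^{[1,\ell]}$ and $\Delta\leq\ell$. For any $m\leq \ell$, the $L_2$-sensitivity of the vector $(\mathrm{count}_{\Delta}(P,\mathcal{D}))_{P\in \Sigma^m}$ (as a function of the database) is at most $\sqrt{2\ell\Delta}$.
   Context: For strings $P,S$, $\mathrm{count}(P,S)$ is the number of positions $i$ with $S[i]\cdots S[i+|P|-1]=P$; $\mathrm{count}_{\Delta}(P,S)=\min(\Delta,\mathrm{count}(P,S))$, and $\mathrm{count}_{\Delta}(P,\mathcal{D})=\sum_{S\in\mathcal{D}}\mathrm{count}_{\Delta}(P,S)$. Two databases are neighboring if one is obtained from the other by replacing one document by another from $\Sigma^{[1,\ell]}$. The $L_2$-sensitivity of $f$ is $\max_{\mathcal{D}\sim\mathcal{D}'}\|f(\mathcal{D})-f(\mathcal{D}')\|_2$ over neighboring pairs. -}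

module Defs where

open import Data.Nat using (ℕ; zero; suc; _+_; _*_; _∸_; _≤_; _⊓_; ∣_-_∣)
open import Data.Fin using (Fin)
open import Data.Fin.Properties using () renaming (_≟_ to _≟ᶠ_)
open import Data.List using (List; []; _∷_; length; take; drop; filter; upTo; allFin; map; concatMap; _++_; [_])
open import Data.List.Properties using (≡-dec)
open import Data.Nat.ListAction using (sum)
open import Data.List.Relation.Unary.All using (All)
open import Relation.Binary.PropositionalEquality using (_≡_)
open import Relation.Nullary using (Dec)

Str : ℕ → Set
Str k = List (Fin k)

_≟ˢ_ : ∀ {k} (u v : Str k) → Dec (u ≡ v)
_≟ˢ_ = ≡-dec _≟ᶠ_

count : ∀ {k} → Str k → Str k → ℕ
count P S = length (filter (λ i → take (length P) (drop i S) ≟ˢ P)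
                           (upTo (suc (length S ∸ length P))))

countΔ : ∀ {k} → ℕ → Str k → Str k → ℕ
countΔ Δ P S = Δ ⊓ count P S

-- a database is a (multi)set of documents, represented as a list
Database : ℕ → Set
Database k = List (Str k)

countΔDB : ∀ {k} → ℕ → Str k → Database k → ℕ
countΔDB Δ P D = sum (map (countΔ Δ P) D)

ValidDoc : ∀ {k} → ℕ → Str k → Set
ValidDoc ℓ S = 1 ≤ length S × length S ≤ ℓ
  where open import Data.Product using (_×_)

ValidDB : ∀ {k} → ℕ → Database k → Set
ValidDB ℓ D = All (ValidDoc ℓ) D

words : ∀ {k} → ℕ → List (Str k)
words zero = [ [] ]
words {k} (suc m) = concatMap (λ a → map (a ∷_) (words m)) (allFin k)

data Neighbor {k : ℕ} : Database k → Database k → Set where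
  replace : (xs ys : Database k) (S S′ : Str k) →
            Neighbor (xs ++ S ∷ ys) (xs ++ S′ ∷ ys)

sqDist : ∀ {k} → ℕ → ℕ → Database k → Database k → ℕ
sqDist Δ m D D′ =
  sum (map (λ P → ∣ countΔDB Δ P D - countΔDB Δ P D′ ∣ * ∣ countΔDB Δ P D - countΔDB Δ P D′ ∣)
           (words m))

-- Only the windows of a document can match a pattern, and a window of length m matches exactly one
-- word of Σ^m, so a document of length at most ℓ contributes at most ℓ to Σ_P count_Δ(P,S) (for
-- m = 0 the single pattern is capped at Δ ≤ ℓ instead). Replacing one document S by S′ changes the
-- P-th coordinate by |a_P - b_P| with a_P = count_Δ(P,S), b_P = count_Δ(P,S′) both in [0,Δ], hence
-- |a_P - b_P|² ≤ Δ (a_P + b_P), and summing over P gives at most Δ (ℓ + ℓ) = 2ℓΔ.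
module Submission where

open import Defs
open import Data.Nat using (ℕ; zero; suc; _+_; _*_; _∸_; _≤_; _⊓_; ∣_-_∣; z≤n; s≤s)
open import Data.Nat.Properties
open import Algebra.Properties.CommutativeSemigroup +-commutativeSemigroup using () renaming (interchange to +-interchange)
open import Data.Nat.ListAction using (sum)
open import Data.Nat.ListAction.Properties using (sum-++)
open import Data.List using (List; []; _∷_; _++_; length; map; filter; take; drop; upTo; allFin; concatMap; cartesianProductWith)
open import Data.List.Properties using (map-++; map-cong; length-upTo; ∷-injective)
open import Data.List.Relation.Unary.All as All using (All; []; _∷_)
import Data.List.Relation.Unary.All.Properties as All
open import Data.List.Relation.Unary.AllPairs using ([]; _∷_)
open import Data.List.Relation.Unary.Unique.Propositional using (Unique)
import Data.List.Relation.Unary.Unique.Propositional.Properties as Unique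
open import Data.Product using (_,_)
open import Function using (_∘_)
open import Relation.Binary.Definitions using (DecidableEquality)
open import Relation.Binary.PropositionalEquality using (_≡_; _≢_; refl; sym; trans; cong; cong₂; setoid; module ≡-Reasoning)
open import Relation.Nullary using (Dec; yes; no; contradiction)

private
  variable
    A B : Set

∑ : List A → (A → ℕ) → ℕ
∑ xs f = sum (map f xs)

syntax ∑ xs (λ x → e) = ∑[ x ∈ xs ] e

∑-cong : ∀ {f g : A → ℕ} (xs : List A) → (∀ x → f x ≡ g x) → ∑ xs f ≡ ∑ xs g
∑-cong xs f≡g = cong sum (map-cong f≡g xs)

∑-mono-≤ : ∀ {f g : A → ℕ} {xs : List A} → All (λ x → f x ≤ g x) xs → ∑ xs f ≤ ∑ xs g
∑-mono-≤ []           = z≤n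
∑-mono-≤ (fx≤gx ∷ ps) = +-mono-≤ fx≤gx (∑-mono-≤ ps)

∑-++ : ∀ (f : A → ℕ) xs ys → ∑ (xs ++ ys) f ≡ ∑ xs f + ∑ ys f
∑-++ f xs ys = trans (cong sum (map-++ f xs ys)) (sum-++ (map f xs) (map f ys))

∑-distrib-+ : ∀ (f g : A → ℕ) xs → ∑[ x ∈ xs ] (f x + g x) ≡ ∑ xs f + ∑ xs g
∑-distrib-+ f g []       = refl
∑-distrib-+ f g (x ∷ xs) =
  trans (cong (f x + g x +_) (∑-distrib-+ f g xs)) (+-interchange (f x) (g x) (∑ xs f) (∑ xs g))

∑-*ˡ : ∀ c (f : A → ℕ) xs → ∑[ x ∈ xs ] (c * f x) ≡ c * ∑ xs f
∑-*ˡ c f []       = sym (*-zeroʳ c)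
∑-*ˡ c f (x ∷ xs) = trans (cong (c * f x +_) (∑-*ˡ c f xs)) (sym (*-distribˡ-+ c (f x) (∑ xs f)))

∑-replace : ∀ (f : A → ℕ) xs x x′ ys → ∣ ∑ (xs ++ x ∷ ys) f - ∑ (xs ++ x′ ∷ ys) f ∣ ≡ ∣ f x - f x′ ∣
∑-replace f xs x x′ ys = begin
  ∣ ∑ (xs ++ x ∷ ys) f - ∑ (xs ++ x′ ∷ ys) f ∣                    ≡⟨ cong₂ ∣_-_∣ (∑-++ f xs (x ∷ ys)) (∑-++ f xs (x′ ∷ ys)) ⟩
  ∣ ∑ xs f + (f x + ∑ ys f) - ∑ xs f + (f x′ + ∑ ys f) ∣          ≡⟨ ∣m+n-m+o∣≡∣n-o∣ (∑ xs f) _ _ ⟩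
  ∣ f x + ∑ ys f - f x′ + ∑ ys f ∣                                ≡⟨ cong₂ ∣_-_∣ (+-comm (f x) _) (+-comm (f x′) _) ⟩
  ∣ ∑ ys f + f x - ∑ ys f + f x′ ∣                                ≡⟨ ∣m+n-m+o∣≡∣n-o∣ (∑ ys f) _ _ ⟩
  ∣ f x - f x′ ∣                                                   ∎
  where open ≡-Reasoning

ind : {X : Set} → Dec X → ℕ
ind (yes _) = 1
ind (no _)  = 0

length-filter-∷ : ∀ {P : A → Set} (P? : ∀ x → Dec (P x)) x xs →
                  length (filter P? (x ∷ xs)) ≡ ind (P? x) + length (filter P? xs)
length-filter-∷ P? x xs with P? x
... | yes _ = refl
... | no  _ = refl

module _ (_≟_ : DecidableEquality B) where

  ∑-ind-≟-absent : ∀ {b : B} {ys} → All (b ≢_) ys → ∑[ y ∈ ys ] ind (b ≟ y) ≡ 0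
  ∑-ind-≟-absent []                = refl
  ∑-ind-≟-absent {b} {y ∷ ys} (b≢y ∷ b∉ys) with b ≟ y
  ... | yes b≡y = contradiction b≡y b≢y
  ... | no  _   = ∑-ind-≟-absent b∉ys

  ∑-ind-≟-unique≤1 : ∀ (b : B) {ys} → Unique ys → ∑[ y ∈ ys ] ind (b ≟ y) ≤ 1
  ∑-ind-≟-unique≤1 b []                           = z≤n
  ∑-ind-≟-unique≤1 b {y ∷ ys} (y∉ys ∷ ys-unique) with b ≟ y
  ... | yes refl = ≤-reflexive (cong suc (∑-ind-≟-absent y∉ys))
  ... | no  _    = ∑-ind-≟-unique≤1 b ys-unique

  ∑-length-fibres≤ : ∀ (f : A → B) xs {ys} → Unique ys →
                     ∑[ y ∈ ys ] length (filter (λ x → f x ≟ y) xs) ≤ length xs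
  ∑-length-fibres≤ f []       {ys} _         = ≤-reflexive (∑-zero ys)
    where
    ∑-zero : ∀ (zs : List B) → ∑[ z ∈ zs ] 0 ≡ 0
    ∑-zero []       = refl
    ∑-zero (_ ∷ zs) = ∑-zero zs
  ∑-length-fibres≤ f (x ∷ xs) {ys} ys-unique = begin
    ∑[ y ∈ ys ] length (filter (λ x → f x ≟ y) (x ∷ xs))
      ≡⟨ ∑-cong ys (λ y → length-filter-∷ (λ x → f x ≟ y) x xs) ⟩
    ∑[ y ∈ ys ] (ind (f x ≟ y) + length (filter (λ x → f x ≟ y) xs))
      ≡⟨ ∑-distrib-+ (λ y → ind (f x ≟ y)) (λ y → length (filter (λ x → f x ≟ y) xs)) ys ⟩
    ∑[ y ∈ ys ] ind (f x ≟ y) + ∑[ y ∈ ys ] length (filter (λ x → f x ≟ y) xs)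
      ≤⟨ +-mono-≤ (∑-ind-≟-unique≤1 (f x) ys-unique) (∑-length-fibres≤ f xs ys-unique) ⟩
    suc (length xs)
      ∎
    where open ≤-Reasoning

concatMap-map≡cartesianProductWith : ∀ {C : Set} (f : A → B → C) xs ys →
  concatMap (λ x → map (f x) ys) xs ≡ cartesianProductWith f xs ys
concatMap-map≡cartesianProductWith f []       ys = refl
concatMap-map≡cartesianProductWith f (x ∷ xs) ys =
  cong (map (f x) ys ++_) (concatMap-map≡cartesianProductWith f xs ys)

words-suc : ∀ {k} m → words {k} (suc m) ≡ cartesianProductWith _∷_ (allFin k) (words m)
words-suc {k} m = concatMap-map≡cartesianProductWith _∷_ (allFin k) (words m)

words-unique : ∀ {k} m → Unique (words {k} m)
words-unique zero            = [] ∷ []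
words-unique {k} (suc m) rewrite words-suc {k} m =
  Unique.cartesianProductWith⁺ _∷_ ∷-injective (Unique.allFin⁺ k) (words-unique m)

words-length : ∀ {k} m → All (λ P → length P ≡ m) (words {k} m)
words-length zero            = refl ∷ []
words-length {k} (suc m) rewrite words-suc {k} m =
  All.cartesianProductWith⁺ (setoid _) (setoid _) _∷_ (allFin k) (words m)
    (λ _ P∈words → cong suc (All.lookup (words-length m) P∈words))

count-length : ∀ {k} m (P S : Str k) → length P ≡ m →
  count P S ≡ length (filter (λ i → take m (drop i S) ≟ˢ P) (upTo (suc (length S ∸ m))))
count-length m P S refl = refl

∑-count-words≤ : ∀ {k} m (S : Str k) → ∑[ P ∈ words m ] count P S ≤ suc (length S ∸ m)
∑-count-words≤ m S = begin
  ∑[ P ∈ words m ] count P S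
    ≤⟨ ∑-mono-≤ (All.map (λ {P} → ≤-reflexive ∘ count-length m P S) (words-length m)) ⟩
  ∑[ P ∈ words m ] length (filter (λ i → take m (drop i S) ≟ˢ P) windows)
    ≤⟨ ∑-length-fibres≤ _≟ˢ_ (λ i → take m (drop i S)) windows (words-unique m) ⟩
  length windows
    ≡⟨ length-upTo _ ⟩
  suc (length S ∸ m) ∎
  where
  open ≤-Reasoning
  windows = upTo (suc (length S ∸ m))

∑-countΔ-words≤ : ∀ {k ℓ Δ} m {S : Str k} → Δ ≤ ℓ → ValidDoc ℓ S → ∑[ P ∈ words m ] countΔ Δ P S ≤ ℓ
∑-countΔ-words≤ {ℓ = ℓ} {Δ} zero    {S} Δ≤ℓ _ = begin
  Δ ⊓ count [] S + 0 ≡⟨ +-identityʳ _ ⟩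
  Δ ⊓ count [] S     ≤⟨ m⊓n≤m Δ _ ⟩
  Δ                  ≤⟨ Δ≤ℓ ⟩
  ℓ                  ∎
  where open ≤-Reasoning
∑-countΔ-words≤ {ℓ = ℓ} {Δ} (suc m) {S} _ (1≤|S| , |S|≤ℓ) = begin
  ∑[ P ∈ words (suc m) ] countΔ Δ P S ≤⟨ ∑-mono-≤ (All.universal (λ P → m⊓n≤n Δ (count P S)) (words (suc m))) ⟩
  ∑[ P ∈ words (suc m) ] count P S    ≤⟨ ∑-count-words≤ (suc m) S ⟩
  suc (length S ∸ suc m)              ≤⟨ windows≤length 1≤|S| ⟩
  length S                            ≤⟨ |S|≤ℓ ⟩
  ℓ                                   ∎
  where
  open ≤-Reasoning
  windows≤length : ∀ {n} → 1 ≤ n → suc (n ∸ suc m) ≤ n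
  windows≤length {suc n} _ = s≤s (m∸n≤m n m)

∣m-n∣*∣m-n∣≤o*[m+n] : ∀ {m n o} → m ≤ o → n ≤ o → ∣ m - n ∣ * ∣ m - n ∣ ≤ o * (m + n)
∣m-n∣*∣m-n∣≤o*[m+n] {m} {n} m≤o n≤o =
  *-mono-≤ (≤-trans (∣m-n∣≤m⊔n m n) (⊔-lub m≤o n≤o)) (≤-trans (∣m-n∣≤m⊔n m n) (m⊔n≤m+n m n))

corollary4p1 : (k ℓ Δ m : ℕ) → Δ ≤ ℓ → m ≤ ℓ →
    (D D′ : Database k) → ValidDB ℓ D → ValidDB ℓ D′ → Neighbor D D′ →
    sqDist Δ m D D′ ≤ 2 * ℓ * Δ
corollary4p1 k ℓ Δ m Δ≤ℓ _ _ _ valid valid′ (replace xs ys S S′) = begin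
  sqDist Δ m (xs ++ S ∷ ys) (xs ++ S′ ∷ ys)
    ≤⟨ ∑-mono-≤ (All.universal coordinate≤ (words m)) ⟩
  ∑[ P ∈ words m ] (Δ * (a P + b P))
    ≡⟨ trans (∑-*ˡ Δ (λ P → a P + b P) (words m)) (cong (Δ *_) (∑-distrib-+ a b (words m))) ⟩
  Δ * (∑ (words m) a + ∑ (words m) b)
    ≤⟨ *-monoʳ-≤ Δ (+-mono-≤ (∑-countΔ-words≤ m Δ≤ℓ (All.head (All.++⁻ʳ xs valid)))
                             (∑-countΔ-words≤ m Δ≤ℓ (All.head (All.++⁻ʳ xs valid′)))) ⟩
  Δ * (ℓ + ℓ)
    ≡⟨ trans (*-comm Δ (ℓ + ℓ)) (cong (λ n → (ℓ + n) * Δ) (sym (+-identityʳ ℓ))) ⟩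
  2 * ℓ * Δ ∎
  where
  open ≤-Reasoning
  a b : Str k → ℕ
  a P = countΔ Δ P S
  b P = countΔ Δ P S′
  coordinate≤ : ∀ P → ∣ countΔDB Δ P (xs ++ S ∷ ys) - countΔDB Δ P (xs ++ S′ ∷ ys) ∣ *
                      ∣ countΔDB Δ P (xs ++ S ∷ ys) - countΔDB Δ P (xs ++ S′ ∷ ys) ∣ ≤ Δ * (a P + b P)
  coordinate≤ P rewrite ∑-replace (countΔ Δ P) xs S S′ ys = ∣m-n∣*∣m-n∣≤o*[m+n] (m⊓n≤m Δ _) (m⊓n≤m Δ _)
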